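{- If $b$ is a base term, $A$ is a type and $\vdash b:S(A)$, then $\vdash b:A$.
   Context: The calculus. Scalars $\alpha\in\mathbb C$. Base qubit types $B ::= \mathbb B \mid B\otimes B$ (set $\mathcal B$); qubit types $\Psi ::= B \mid S(\Psi)\mid \Psi\otimes\Psi$; types $A ::= \Psi\mid \Psi\Rightarrow A\mid S(A)\mid A\otimes A$. Base terms $b ::= x \mid \lambda x{:}\Psi.\,t \mid |0\rangle\mid |1\rangle\mid b\otimes b$; terms $t ::= b\mid\vec 0\mid t\,t\mid t+t\mid \pi_j t\mid \mathsf{ite}\mid \alpha.t\mid t\otimes t\mid \mathsf{head}\,t\mid \mathsf{tail}\,t\mid \Uparrow^{A}_{B\otimes C} t$ ($\vec 0_A$ null-vector constants, $\mathsf{ite}$ constant, $\pi_j$ measurement, $\Uparrow$ cast); $+$ is associative and commutative. Contexts assign qubit types to variables; $\Gamma,\Delta$ has disjoint supports. Subtyping $\preceq$: reflexive-transitive relation generated by $A\preceq S(A)$, $S(S(A))\preceq S(A)$, and if $A\preceq B$ then $\Psi\Rightarrow A\preceq\Psi\Rightarrow B$, $S(A)\preceq S(B)$, $A\otimes C\preceq B\otimes C$, $C\otimes A\preceq C\otimes B$. $Q_n^S$ ($S\subseteq\{1,\dots,n\}$): $A_0^{\emptyset}(X)=X$; $A_{k+1}^S(\mathbb B)=A_k^S(\mathbb B)\otimes\mathbb B$ if $k+1\notin S$, else $A_k^{S\setminus\{k+1\}}(S(\mathbb B))\otimes\mathbb B$; $A_{k+1}^S(S(X))=A_k^S(\mathbb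 B)\otimes S(X)$ if $k+1\notin S$, else $A_k^{S\setminus\{k+1\}}(S(\mathbb B\otimes X))$; $Q_n^S=A_{n-1}^S(\mathbb B)$ if $n\notin S$, else $A_{n-1}^{S\setminus\{n\}}(S(\mathbb B))$. Typing rules: $x:\Psi\vdash x:\Psi$; $\vdash\vec 0_A:S(A)$; $\vdash|0\rangle:\mathbb B$; $\vdash|1\rangle:\mathbb B$; $\Gamma\vdash t:A$ gives $\Gamma\vdash\alpha.t:S(A)$; $\Gamma\vdash t:A$, $\Delta\vdash u:A$ give $\Gamma,\Delta\vdash t+u:S(A)$; $\Gamma\vdash t:Q_n^S$ gives $\Gamma\vdash\pi_jt:Q_n^{S\setminus\{1,\dots,j\}}$; $\Gamma\vdash t:A$, $A\preceq B$ give $\Gamma\vdash t:B$; $\vdash\mathsf{ite}:\mathbb B\Rightarrow\mathbb B\Rightarrow\mathbb B\Rightarrow\mathbb B$; $\Gamma,x:\Psi\vdash t:A$ gives $\Gamma\vdash\lambda x{:}\Psi.\,t:\Psi\Rightarrow A$; $\Gamma\vdash t:\Psi\Rightarrow A$, $\Delta\vdash u:\Psi$ give $\Gamma,\Delta\vdash tu:A$; $\Gamma\vdash t:S(\Psi\Rightarrow A)$, $\Delta\vdash u:S(\Psi)$ give $\Gamma,\Delta\vdash tu:S(A)$; weakening $\Gamma,x:B\vdash t:A$ from $\Gamma\vdash t:A$ and contraction $\Gamma,x:B\vdash(x/y)t:A$ from $\Gamma,x:B,y:B\vdash t:A$ ($B\in\mathcal B$); $\Gamma\vdash t:A$, $\Delta\vdash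 u:B$ give $\Gamma,\Delta\vdash t\otimes u:A\otimes B$; $\Gamma\vdash t:\mathbb B\otimes B$ gives $\Gamma\vdash\mathsf{head}\,t:\mathbb B$, $\Gamma\vdash\mathsf{tail}\,t:B$; $\Gamma\vdash t:S(S(A)\otimes B)$ gives $\Gamma\vdash\Uparrow^{S(A)\otimes B}_{A\otimes B}t:S(A\otimes B)$; $\Gamma\vdash t:S(A\otimes S(B))$ gives $\Gamma\vdash\Uparrow^{A\otimes S(B)}_{A\otimes B}t:S(A\otimes B)$; $\Gamma\vdash\Uparrow^B_At:S(A)$ gives $\Gamma\vdash\Uparrow^B_A\alpha.t:S(A)$; $\Gamma\vdash\Uparrow^B_At:S(A)$, $\Delta\vdash\Uparrow^B_Ar:S(A)$ give $\Gamma,\Delta\vdash\Uparrow^B_A(t+r):S(A)$. -}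

module Defs where

open import Data.Nat using (ℕ; zero; suc; _<ᵇ_)
open import Data.Bool using (Bool; true; false; if_then_else_; _∧_)
open import Data.Fin using (Fin; _≟_) renaming (zero to fz; suc to fs)
open import Data.Maybe using (Maybe; just; nothing)
open import Data.Vec using (Vec; []; _∷_; replicate; lookup; _[_]≔_)
open import Relation.Nullary using (¬_; yes; no)
open import Relation.Binary.PropositionalEquality using (_≡_)

infixr 7 _⊗_
infixr 5 _⇒_

data Ty : Set where
  𝔹   : Ty
  S   : Ty → Ty
  _⊗_ : Ty → Ty → Ty
  _⇒_ : Ty → Ty → Ty

data IsBaseTy : Ty → Set where
  𝔹-base : IsBaseTy 𝔹
  ⊗-base : ∀ {B C} → IsBaseTy B → IsBaseTy C → IsBaseTy (B ⊗ C)

data IsQubitTy : Ty → Set where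
  base-q : ∀ {B} → IsBaseTy B → IsQubitTy B
  S-q    : ∀ {Ψ} → IsQubitTy Ψ → IsQubitTy (S Ψ)
  ⊗-q    : ∀ {Ψ Φ} → IsQubitTy Ψ → IsQubitTy Φ → IsQubitTy (Ψ ⊗ Φ)

data IsType : Ty → Set where
  qubit-t : ∀ {Ψ} → IsQubitTy Ψ → IsType Ψ
  ⇒-t     : ∀ {Ψ A} → IsQubitTy Ψ → IsType A → IsType (Ψ ⇒ A)
  S-t     : ∀ {A} → IsType A → IsType (S A)
  ⊗-t     : ∀ {A C} → IsType A → IsType C → IsType (A ⊗ C)

infix 4 _≼_

data _≼_ : Ty → Ty → Set where
  ≼-refl  : ∀ {A} → A ≼ A
  ≼-trans : ∀ {A B C} → A ≼ B → B ≼ C → A ≼ C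
  ≼-S     : ∀ {A} → A ≼ S A
  ≼-SS    : ∀ {A} → S (S A) ≼ S A
  ≼-⇒     : ∀ {Ψ A B} → A ≼ B → (Ψ ⇒ A) ≼ (Ψ ⇒ B)
  ≼-Scong : ∀ {A B} → A ≼ B → S A ≼ S B
  ≼-⊗l    : ∀ {A B C} → A ≼ B → (A ⊗ C) ≼ (B ⊗ C)
  ≼-⊗r    : ∀ {A B C} → A ≼ B → (C ⊗ A) ≼ (C ⊗ B)

-- A subset S ⊆ {1,…,n} is represented by its
-- characteristic function  ℕ → Bool  (only the values at 1,…,n matter).
-- The argument X of A_k^S is always 𝔹 or S(X'), recorded by Arg.

data Arg : Set where
  arg𝔹 : Arg
  argS : Ty → Arg

argTy : Arg → Ty
argTy arg𝔹     = 𝔹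
argTy (argS X) = S X

remove : (ℕ → Bool) → ℕ → (ℕ → Bool)
remove s i k with Data.Nat._≟_ k i
... | yes _ = false
... | no  _ = s k

Aₖ : ℕ → (ℕ → Bool) → Arg → Ty
Aₖ zero    s X        = argTy X
Aₖ (suc k) s arg𝔹     =
  if s (suc k) then Aₖ k (remove s (suc k)) (argS 𝔹) ⊗ 𝔹
               else Aₖ k s arg𝔹 ⊗ 𝔹
Aₖ (suc k) s (argS X) =
  if s (suc k) then Aₖ k (remove s (suc k)) (argS (𝔹 ⊗ X))
               else Aₖ k s arg𝔹 ⊗ S X

Q : (n : ℕ) → .{{_ : Data.Nat.NonZero n}} → (ℕ → Bool) → Ty
Q (suc m) s = if s (suc m) then Aₖ m (remove s (suc m)) (argS 𝔹)
                          else Aₖ m s arg𝔹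

dropUpTo : ℕ → (ℕ → Bool) → (ℕ → Bool)
dropUpTo j s k = s k ∧ (j <ᵇ k)

module _ (Scalar : Set) where

  data Tm (n : ℕ) : Set where
    var    : Fin n → Tm n
    lam    : Ty → Tm (suc n) → Tm n
    ket0   : Tm n
    ket1   : Tm n
    null   : Ty → Tm n
    app    : Tm n → Tm n → Tm n
    plus   : Tm n → Tm n → Tm n
    proj   : ℕ → Tm n → Tm n
    ite    : Tm n
    scal   : Scalar → Tm n → Tm n
    tensor : Tm n → Tm n → Tm n
    head   : Tm n → Tm n
    tail   : Tm n → Tm n
    cast   : Ty → Ty → Tm n → Tm n                -- ⇑^B_A t  is  cast B A t

  data IsBaseTerm {n : ℕ} : Tm n → Set where
    var-b    : ∀ {i} → IsBaseTerm (var i)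
    lam-b    : ∀ {Ψ t} → IsBaseTerm (lam Ψ t)
    ket0-b   : IsBaseTerm ket0
    ket1-b   : IsBaseTerm ket1
    tensor-b : ∀ {b c} → IsBaseTerm b → IsBaseTerm c → IsBaseTerm (tensor b c)

  ext : ∀ {n m} → (Fin n → Fin m) → Fin (suc n) → Fin (suc m)
  ext ρ fz     = fz
  ext ρ (fs i) = fs (ρ i)

  rename : ∀ {n m} → (Fin n → Fin m) → Tm n → Tm m
  rename ρ (var i)        = var (ρ i)
  rename ρ (lam Ψ t)      = lam Ψ (rename (ext ρ) t)
  rename ρ ket0           = ket0
  rename ρ ket1           = ket1
  rename ρ (null A)       = null A
  rename ρ (app t u)      = app (rename ρ t) (rename ρ u)
  rename ρ (plus t u)     = plus (rename ρ t) (rename ρ u)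
  rename ρ (proj j t)     = proj j (rename ρ t)
  rename ρ ite            = ite
  rename ρ (scal α t)     = scal α (rename ρ t)
  rename ρ (tensor t u)   = tensor (rename ρ t) (rename ρ u)
  rename ρ (head t)       = head (rename ρ t)
  rename ρ (tail t)       = tail (rename ρ t)
  rename ρ (cast B A t)   = cast B A (rename ρ t)

  swapTo : ∀ {n} → Fin n → Fin n → Fin n → Fin n
  swapTo x y k with k ≟ y
  ... | yes _ = x
  ... | no  _ = k

  Ctx : ℕ → Set
  Ctx n = Vec (Maybe Ty) n

  ∅ : ∀ {n} → Ctx n
  ∅ = replicate _ nothing

  data Split : ∀ {n} → Ctx n → Ctx n → Ctx n → Set where
    []  : Split [] [] []
    n∷  : ∀ {n} {Γ Γ₁ Γ₂ : Ctx n} → Split Γ Γ₁ Γ₂ →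
          Split (nothing ∷ Γ) (nothing ∷ Γ₁) (nothing ∷ Γ₂)
    l∷  : ∀ {n A} {Γ Γ₁ Γ₂ : Ctx n} → Split Γ Γ₁ Γ₂ →
          Split (just A ∷ Γ) (just A ∷ Γ₁) (nothing ∷ Γ₂)
    r∷  : ∀ {n A} {Γ Γ₁ Γ₂ : Ctx n} → Split Γ Γ₁ Γ₂ →
          Split (just A ∷ Γ) (nothing ∷ Γ₁) (just A ∷ Γ₂)

  infix 3 _⊢_∶_

  data _⊢_∶_ : ∀ {n} → Ctx n → Tm n → Ty → Set where
    ax     : ∀ {n Ψ} (i : Fin n) → IsQubitTy Ψ →
             (∅ [ i ]≔ just Ψ) ⊢ var i ∶ Ψ
    ax0⃗    : ∀ {n A} → ∅ {n} ⊢ null A ∶ S A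
    ax|0⟩  : ∀ {n} → ∅ {n} ⊢ ket0 ∶ 𝔹
    ax|1⟩  : ∀ {n} → ∅ {n} ⊢ ket1 ∶ 𝔹
    sI     : ∀ {n} {Γ : Ctx n} {t A} (α : Scalar) →
             Γ ⊢ t ∶ A → Γ ⊢ scal α t ∶ S A
    sPlus  : ∀ {n} {Γ Γ₁ Γ₂ : Ctx n} {t u A} → Split Γ Γ₁ Γ₂ →
             Γ₁ ⊢ t ∶ A → Γ₂ ⊢ u ∶ A → Γ ⊢ plus t u ∶ S A
    meas   : ∀ {n} {Γ : Ctx n} {t} (m : ℕ) (s : ℕ → Bool) (j : ℕ) →
             Γ ⊢ t ∶ Q (suc m) s → Γ ⊢ proj j t ∶ Q (suc m) (dropUpTo j s)
    sub    : ∀ {n} {Γ : Ctx n} {t A B} → Γ ⊢ t ∶ A → A ≼ B → Γ ⊢ t ∶ B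
    axIte  : ∀ {n} → ∅ {n} ⊢ ite ∶ 𝔹 ⇒ 𝔹 ⇒ 𝔹 ⇒ 𝔹
    ⇒I     : ∀ {n} {Γ : Ctx n} {Ψ t A} → IsQubitTy Ψ →
             (just Ψ ∷ Γ) ⊢ t ∶ A → Γ ⊢ lam Ψ t ∶ Ψ ⇒ A
    ⇒E     : ∀ {n} {Γ Γ₁ Γ₂ : Ctx n} {t u Ψ A} → Split Γ Γ₁ Γ₂ →
             Γ₁ ⊢ t ∶ Ψ ⇒ A → Γ₂ ⊢ u ∶ Ψ → Γ ⊢ app t u ∶ A
    ⇒ES    : ∀ {n} {Γ Γ₁ Γ₂ : Ctx n} {t u Ψ A} → Split Γ Γ₁ Γ₂ →
             Γ₁ ⊢ t ∶ S (Ψ ⇒ A) → Γ₂ ⊢ u ∶ S Ψ → Γ ⊢ app t u ∶ S A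
    weak   : ∀ {n} {Γ : Ctx n} {t A B} (i : Fin n) → IsBaseTy B →
             lookup Γ i ≡ nothing → Γ ⊢ t ∶ A → (Γ [ i ]≔ just B) ⊢ t ∶ A
    contr  : ∀ {n} {Γ : Ctx n} {t A B} (x y : Fin n) → IsBaseTy B →
             ¬ (x ≡ y) → lookup Γ x ≡ just B → lookup Γ y ≡ just B →
             Γ ⊢ t ∶ A → (Γ [ y ]≔ nothing) ⊢ rename (swapTo x y) t ∶ A
    ⊗I     : ∀ {n} {Γ Γ₁ Γ₂ : Ctx n} {t u A B} → Split Γ Γ₁ Γ₂ →
             Γ₁ ⊢ t ∶ A → Γ₂ ⊢ u ∶ B → Γ ⊢ tensor t u ∶ A ⊗ B
    ⊗Er    : ∀ {n} {Γ : Ctx n} {t B} → IsBaseTy B →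
             Γ ⊢ t ∶ 𝔹 ⊗ B → Γ ⊢ head t ∶ 𝔹
    ⊗El    : ∀ {n} {Γ : Ctx n} {t B} → IsBaseTy B →
             Γ ⊢ t ∶ 𝔹 ⊗ B → Γ ⊢ tail t ∶ B
    ⇑r     : ∀ {n} {Γ : Ctx n} {t A B} →
             Γ ⊢ t ∶ S (S A ⊗ B) → Γ ⊢ cast (S A ⊗ B) (A ⊗ B) t ∶ S (A ⊗ B)
    ⇑l     : ∀ {n} {Γ : Ctx n} {t A B} →
             Γ ⊢ t ∶ S (A ⊗ S B) → Γ ⊢ cast (A ⊗ S B) (A ⊗ B) t ∶ S (A ⊗ B)
    ⇑α     : ∀ {n} {Γ : Ctx n} {t A B} (α : Scalar) →
             Γ ⊢ cast B A t ∶ S A → Γ ⊢ cast B A (scal α t) ∶ S A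
    ⇑+     : ∀ {n} {Γ Γ₁ Γ₂ : Ctx n} {t r A B} → Split Γ Γ₁ Γ₂ →
             Γ₁ ⊢ cast B A t ∶ S A → Γ₂ ⊢ cast B A r ∶ S A →
             Γ ⊢ cast B A (plus t r) ∶ S A

{-# OPTIONS --safe #-}
module Submission where

open import Defs

-- Stripping the outer S's of a type is monotone for ≼, and a closed base
-- term is typed by |0⟩, |1⟩, λ or ⊗ introduction (whose type has no outer
-- S) followed by subsumptions.  Hence ⊢ b ∶ S A yields ⊢ b ∶ stripS A, and
-- stripS A ≼ A.

stripS : Ty → Ty
stripS (S A) = stripS A
stripS A     = A

stripS-≼ : ∀ A → stripS A ≼ A
stripS-≼ 𝔹       = ≼-refl
stripS-≼ (S A)   = ≼-trans (stripS-≼ A) ≼-S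
stripS-≼ (A ⊗ B) = ≼-refl
stripS-≼ (A ⇒ B) = ≼-refl

stripS-mono : ∀ {A B} → A ≼ B → stripS A ≼ stripS B
stripS-mono ≼-refl        = ≼-refl
stripS-mono (≼-trans p q) = ≼-trans (stripS-mono p) (stripS-mono q)
stripS-mono ≼-S           = ≼-refl
stripS-mono ≼-SS          = ≼-refl
stripS-mono (≼-⇒ p)       = ≼-⇒ p
stripS-mono (≼-Scong p)   = stripS-mono p
stripS-mono (≼-⊗l p)      = ≼-⊗l p
stripS-mono (≼-⊗r p)      = ≼-⊗r p

module _ (Scalar : Set) where

  closed-base-⊢-stripS : ∀ {Γ : Ctx Scalar 0} {b T} → IsBaseTerm Scalar b →
                         _⊢_∶_ Scalar Γ b T → _⊢_∶_ Scalar Γ b (stripS T)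
  closed-base-⊢-stripS _      ax|0⟩          = ax|0⟩
  closed-base-⊢-stripS _      ax|1⟩          = ax|1⟩
  closed-base-⊢-stripS _      d@(⇒I _ _)     = d
  closed-base-⊢-stripS _      d@(⊗I _ _ _)   = d
  closed-base-⊢-stripS base-b (sub d p)      =
    sub (closed-base-⊢-stripS base-b d) (stripS-mono p)
  closed-base-⊢-stripS _      (ax () _)
  closed-base-⊢-stripS _      (weak () _ _ _)
  closed-base-⊢-stripS _      (contr () _ _ _ _ _ _)
  closed-base-⊢-stripS ()     ax0⃗
  closed-base-⊢-stripS ()     (sI _ _)
  closed-base-⊢-stripS ()     (sPlus _ _ _)
  closed-base-⊢-stripS ()     (meas _ _ _ _)
  closed-base-⊢-stripS ()     axIte
  closed-base-⊢-stripS ()     (⇒E _ _ _)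
  closed-base-⊢-stripS ()     (⇒ES _ _ _)
  closed-base-⊢-stripS ()     (⊗Er _ _)
  closed-base-⊢-stripS ()     (⊗El _ _)
  closed-base-⊢-stripS ()     (⇑r _)
  closed-base-⊢-stripS ()     (⇑l _)
  closed-base-⊢-stripS ()     (⇑α _ _)
  closed-base-⊢-stripS ()     (⇑+ _ _ _)

corollary2 : (Scalar : Set) (b : Tm Scalar 0) (A : Ty) →
             IsBaseTerm Scalar b → IsType A →
             _⊢_∶_ Scalar (∅ Scalar) b (S A) →
             _⊢_∶_ Scalar (∅ Scalar) b A
corollary2 Scalar b A base-b _ d =
  sub (closed-base-⊢-stripS Scalar base-b d) (stripS-≼ A)
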